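{- Let $\mathcal{H}$ be a $k$-uniform hypergraph. Then for all positive integers $t$ and $m$ and every $e\le e(\mathcal{H})$, there is a sub-hypergraph $\mathcal{H}'\subseteq\mathcal{H}$ such that one of the following holds: \begin{enumerate} \item $e(\mathcal{H}')\ge e(\mathcal{H})-e$ and every set $R$ of $t$ vertices has $\deg_{\mathcal{H}'}(R)<m$; \item $\mathcal{H}'$ has an $(m,t)$-bucket decomposition and $e(\mathcal{H}')\ge e$. \end{enumerate}
   Context: $e(\cdot)$ is the number of edges; $\deg_{\mathcal{H}'}(R)$ is the number of edges of $\mathcal{H}'$ containing the vertex set $R$. A bucket is a pair $(\mathcal{E},X)$ where $\mathcal{E}$ is a set of edges all containing the vertex set $X$. An $(m,t)$-bucket decomposition is a partition of the edge set into buckets $(\mathcal{E}_i,X_i)$ with $|\mathcal{E}_i|=m$ and $|X_i|=t$. -}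

module Defs where

open import Data.Nat using (ℕ; _≡ᵇ_)
open import Data.Fin.Subset using (Subset; _⊆_; ∣_∣)
open import Data.Fin.Subset.Properties using (_⊆?_)
open import Data.List using (List; length; filter; concat; map)
open import Data.List.Relation.Unary.All using (All)
open import Data.List.Relation.Unary.Unique.Propositional using (Unique)
open import Data.List.Membership.Propositional using (_∈_)
open import Data.List.Relation.Binary.Permutation.Propositional using (_↭_)
open import Data.Product using (_×_; _,_; proj₁; proj₂)
open import Relation.Binary.PropositionalEquality using (_≡_)

record Hypergraph (n : ℕ) : Set where
  constructor mkHG
  field
    edges  : List (Subset n)
    simple : Unique edges
open Hypergraph public

Uniform : ∀ {n} → ℕ → Hypergraph n → Set
Uniform k H = All (λ E → ∣ E ∣ ≡ k) (edges H)

e[_] : ∀ {n} → Hypergraph n → ℕ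
e[ H ] = length (edges H)

_⊑_ : ∀ {n} → Hypergraph n → Hypergraph n → Set
H' ⊑ H = All (λ E → E ∈ edges H) (edges H')

deg : ∀ {n} → Hypergraph n → Subset n → ℕ
deg H R = length (filter (R ⊆?_) (edges H))

Bucket : ℕ → Set
Bucket n = List (Subset n) × Subset n

IsBucket : ∀ {n} → Bucket n → Set
IsBucket (𝓔 , X) = All (λ E → X ⊆ E) 𝓔

record BucketDecomposition {n} (m t : ℕ) (H : Hypergraph n) : Set where
  field
    buckets   : List (Bucket n)
    isBucket  : All IsBucket buckets
    sizeEdges : All (λ b → length (proj₁ b) ≡ m) buckets
    sizeSet   : All (λ b → ∣ proj₂ b ∣ ≡ t) buckets
    partition : concat (map proj₁ buckets) ↭ edges H

{-# OPTIONS --safe #-}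
-- Greedy peeling. As long as fewer than e edges have been put into buckets
-- and some t-set R lies in at least m of the remaining edges, move m of those
-- edges into a new bucket with key R. Each round removes m ≥ 1 edges, so this
-- stops: either the buckets cover at least e edges (outcome 2), or no t-set
-- has degree m in the remaining edges, of which there are at least e(H) − e
-- because fewer than e edges were bucketed (outcome 1).
module Submission where

open import Defs
open import Data.Nat using (ℕ; zero; suc; _≤_; _<_; _∸_; _+_; _≟_; _≤?_; s≤s⁻¹)
open import Data.Nat.Properties
  using (≤-trans; ≤-reflexive; <⇒≤; ≰⇒>; +-monoˡ-≤; m<n+m; m≤n+o⇒m∸n≤o)
open import Data.Nat.Induction using (<-wellFounded)
open import Data.Fin.Subset using (Subset; ∣_∣)
open import Data.Fin.Subset.Properties using (_⊆?_; anySubset?)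
open import Data.Product using (Σ; _×_; _,_; proj₁; proj₂)
open import Data.Sum using (_⊎_; inj₁; inj₂)
open import Data.List using (List; []; _∷_; _++_; length; filter; concat; map)
open import Data.List.Properties using (length-++; ++-assoc)
open import Data.List.Relation.Unary.All as All using (All; []; _∷_)
open import Data.List.Relation.Unary.All.Properties using (++⁻ˡ)
open import Data.List.Relation.Unary.Unique.Propositional using (Unique)
open import Data.List.Relation.Unary.AllPairs using ([]; _∷_)
open import Data.List.Membership.Propositional.Properties using (∈-++⁺ˡ; ∈-++⁺ʳ)
open import Data.List.Relation.Binary.Permutation.Propositional
  using (_↭_; ↭-refl; ↭-sym; ↭-trans; ↭-prep; ↭⇒↭ₛ; module PermutationReasoning)
open import Data.List.Relation.Binary.Permutation.Propositional.Properties
  using (∈-resp-↭; ↭-length; ++⁺ˡ; shift; shifts)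
import Data.List.Relation.Binary.Permutation.Setoid.Properties as SetoidPerm
open import Induction.WellFounded using (Acc; acc)
open import Level using (0ℓ)
open import Relation.Binary.PropositionalEquality using (_≡_; refl; sym; trans; cong; module ≡-Reasoning)
open import Relation.Binary.PropositionalEquality.Properties using (setoid)
open import Relation.Nullary using (yes; no)
open import Relation.Nullary.Decidable using (_×-dec_)
open import Relation.Unary using (Pred; Decidable)

private variable
  A : Set

Unique-++⁻ˡ : (xs : List A) {ys : List A} → Unique (xs ++ ys) → Unique xs
Unique-++⁻ˡ []       _          = []
Unique-++⁻ˡ (x ∷ xs) (x∉ ∷ xs!) = ++⁻ˡ xs x∉ ∷ Unique-++⁻ˡ xs xs!

Unique-++⁻ʳ : (xs : List A) {ys : List A} → Unique (xs ++ ys) → Unique ys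
Unique-++⁻ʳ []       ys!        = ys!
Unique-++⁻ʳ (x ∷ xs) (_ ∷ xs!) = Unique-++⁻ʳ xs xs!

Unique-resp-↭ : {xs ys : List A} → xs ↭ ys → Unique xs → Unique ys
Unique-resp-↭ {A} xs↭ys = SetoidPerm.Unique-resp-↭ (setoid A) (↭⇒↭ₛ xs↭ys)

module _ {P : Pred A 0ℓ} (P? : Decidable P) where

  record Selection (m : ℕ) (xs : List A) : Set where
    constructor selection
    field
      chosen        : List A
      others        : List A
      length-chosen : length chosen ≡ m
      all-chosen    : All P chosen
      reassemble    : chosen ++ others ↭ xs

  private
    choose : ∀ {x m xs} → P x → Selection m xs → Selection (suc m) (x ∷ xs)
    choose {x} px (selection c o len all perm) =
      selection (x ∷ c) o (cong suc len) (px ∷ all) (↭-prep x perm)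

    pass : ∀ {x m xs} → Selection m xs → Selection m (x ∷ xs)
    pass {x} (selection c o len all perm) =
      selection c (x ∷ o) len all (↭-trans (shift x c o) (↭-prep x perm))

  select : ∀ m xs → m ≤ length (filter P? xs) → Selection m xs
  select zero    xs       _ = selection [] xs refl [] ↭-refl
  select (suc m) (x ∷ xs) m≤ with P? x
  ... | yes px = choose px (select m xs (s≤s⁻¹ m≤))
  ... | no  _  = pass (select (suc m) xs m≤)

module Split {n} (H : Hypergraph n) {xs ys : List (Subset n)} (split : xs ++ ys ↭ edges H) where

  private
    unique : Unique (xs ++ ys)
    unique = Unique-resp-↭ (↭-sym split) (simple H)

  splitˡ : Hypergraph n
  splitˡ = mkHG xs (Unique-++⁻ˡ xs unique)

  splitʳ : Hypergraph n
  splitʳ = mkHG ys (Unique-++⁻ʳ xs unique)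

  splitˡ-⊑ : splitˡ ⊑ H
  splitˡ-⊑ = All.tabulate (λ x∈xs → ∈-resp-↭ split (∈-++⁺ˡ x∈xs))

  splitʳ-⊑ : splitʳ ⊑ H
  splitʳ-⊑ = All.tabulate (λ y∈ys → ∈-resp-↭ split (∈-++⁺ʳ xs y∈ys))

  e-split : e[ H ] ≡ e[ splitˡ ] + e[ splitʳ ]
  e-split = trans (sym (↭-length split)) (length-++ xs)

  e-splitˡ≤⇒e∸≤e-splitʳ : ∀ {e} → e[ splitˡ ] ≤ e → e[ H ] ∸ e ≤ e[ splitʳ ]
  e-splitˡ≤⇒e∸≤e-splitʳ {e} ≤e = m≤n+o⇒m∸n≤o e[ H ] e
    (≤-trans (≤-reflexive e-split) (+-monoˡ-≤ e[ splitʳ ] ≤e))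

record Peeling {n} (m t : ℕ) (H : Hypergraph n) : Set where
  field
    buckets   : List (Bucket n)
    remaining : List (Subset n)
    isBucket  : All IsBucket buckets
    sizeEdges : All (λ b → length (proj₁ b) ≡ m) buckets
    sizeSet   : All (λ b → ∣ proj₂ b ∣ ≡ t) buckets
    partition : concat (map proj₁ buckets) ++ remaining ↭ edges H

  covered : List (Subset n)
  covered = concat (map proj₁ buckets)

  open Split H {covered} {remaining} partition public
    renaming ( splitˡ to bucketed ; splitʳ to unbucketed
             ; splitˡ-⊑ to bucketed-⊑ ; splitʳ-⊑ to unbucketed-⊑
             ; e-splitˡ≤⇒e∸≤e-splitʳ to e-bucketed≤⇒e∸≤e-unbucketed )

  bucketed-decomposition : BucketDecomposition m t bucketed
  bucketed-decomposition = record
    { buckets = buckets ; isBucket = isBucket ; sizeEdges = sizeEdges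
    ; sizeSet = sizeSet ; partition = ↭-refl }

open Peeling

module _ {n} {m t : ℕ} {H : Hypergraph n} where

  unpeeled : Peeling m t H
  unpeeled = record
    { buckets = [] ; remaining = edges H ; isBucket = [] ; sizeEdges = []
    ; sizeSet = [] ; partition = ↭-refl }

  module _ (P : Peeling m t H) (R : Subset n) (∣R∣≡t : ∣ R ∣ ≡ t)
           (dense : m ≤ deg (unbucketed P) R) where

    private
      S : Selection (R ⊆?_) m (remaining P)
      S = select (R ⊆?_) m (remaining P) dense
      open Selection S

    peel : Peeling m t H
    peel = record
      { buckets   = (chosen , R) ∷ buckets P
      ; remaining = others
      ; isBucket  = all-chosen ∷ isBucket P
      ; sizeEdges = length-chosen ∷ sizeEdges P
      ; sizeSet   = ∣R∣≡t ∷ sizeSet P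
      ; partition = begin
          (chosen ++ covered P) ++ others  ≡⟨ ++-assoc chosen (covered P) others ⟩
          chosen ++ covered P ++ others    ↭⟨ shifts chosen (covered P) ⟩
          covered P ++ chosen ++ others    ↭⟨ ++⁺ˡ (covered P) reassemble ⟩
          covered P ++ remaining P         ↭⟨ partition P ⟩
          edges H                          ∎
      }
      where open PermutationReasoning

    length-remaining-peel : length (remaining P) ≡ m + length (remaining peel)
    length-remaining-peel = begin
      length (remaining P)             ≡⟨ sym (↭-length reassemble) ⟩
      length (chosen ++ others)        ≡⟨ length-++ chosen ⟩
      length chosen + length others    ≡⟨ cong (_+ length others) length-chosen ⟩
      m + length others                ∎
      where open ≡-Reasoning

    peel-shrinks : 1 ≤ m → length (remaining peel) < length (remaining P)
    peel-shrinks m≥1 = ≤-trans (m<n+m _ m≥1) (≤-reflexive (sym length-remaining-peel))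

module _ {n} (H : Hypergraph n) (t m e : ℕ) (m≥1 : 1 ≤ m) where

  Outcome : Hypergraph n → Set
  Outcome H' = H' ⊑ H ×
    ((e[ H ] ∸ e ≤ e[ H' ] × (∀ (R : Subset n) → ∣ R ∣ ≡ t → deg H' R < m))
     ⊎ (BucketDecomposition m t H' × e ≤ e[ H' ]))

  peelGreedily : (P : Peeling m t H) → Acc _<_ (length (remaining P)) →
                 Σ (Hypergraph n) Outcome
  peelGreedily P (acc smaller) with e ≤? e[ bucketed P ]
  ... | yes e≤ = bucketed P , bucketed-⊑ P , inj₂ (bucketed-decomposition P , e≤)
  ... | no  e≰ with anySubset? (λ R → (∣ R ∣ ≟ t) ×-dec (m ≤? deg (unbucketed P) R))
  ...   | yes (R , ∣R∣≡t , dense) = peelGreedily (peel P R ∣R∣≡t dense)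
            (smaller (peel-shrinks P R ∣R∣≡t dense m≥1))
  ...   | no  noDense = unbucketed P , unbucketed-⊑ P , inj₁
            ( e-bucketed≤⇒e∸≤e-unbucketed P (<⇒≤ (≰⇒> e≰))
            , λ R ∣R∣≡t → ≰⇒> (λ dense → noDense (R , ∣R∣≡t , dense)) )

lemma4p1 : ∀ {n} (k : ℕ) (H : Hypergraph n) → Uniform k H →
    ∀ (t m : ℕ) → 1 ≤ t → 1 ≤ m → ∀ (e : ℕ) → e ≤ e[ H ] →
    Σ (Hypergraph n) λ H' → H' ⊑ H ×
      ((e[ H ] ∸ e ≤ e[ H' ] × (∀ (R : Subset n) → ∣ R ∣ ≡ t → deg H' R < m))
       ⊎ (BucketDecomposition m t H' × e ≤ e[ H' ]))
lemma4p1 k H _ t m _ m≥1 e _ = peelGreedily H t m e m≥1 unpeeled (<-wellFounded _)
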